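{- Work in Bishop-style constructive mathematics. If every monotone $\Pi^0_1$ bar of the binary fan $\{0,1\}^*$ is uniform, then for every fan $T$, every monotone $\Pi^0_1$ bar of $T$ is uniform.
   Context: $\mathbb{N}^*$ is the set of finite sequences of natural numbers, $\{0,1\}^*$ the finite binary sequences, $a*b$ concatenation, $\overline{\alpha}n$ the initial segment of length $n$ of $\alpha$. A tree is an inhabited decidable subset of $\mathbb{N}^*$ closed under initial segments. A spread is a tree $T$ with $\forall a\in T\,\exists n\,(a*\langle n\rangle\in T)$; a path of $T$ is $\alpha$ with $\forall n\,(\overline{\alpha}n\in T)$. A fan is a spread $T$ with $\forall a\in T\,\exists N\,\forall n\,[a*\langle n\rangle\in T\to n\le N]$. For a spread $T$, $P\subseteq T$ is a bar of $T$ if every path $\alpha$ of $T$ has some $n$ with $\overline{\alpha}n\in P$; a uniform bar if there is $N$ such that every path of $T$ has some $n\le N$ with $\overline{\alpha}n\in P$; $\Pi^0_1$ if $P=\bigcap_n B_n$ with each $B_n\subseteq T$ decidable; monotone if $a\in P$, $a*b\in T$ imply $a*b\in P$. -}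

module Defs where

open import Data.Nat using (ℕ; _≤_)
open import Data.List using (List; []; _∷_; _++_; [_]; applyUpTo)
open import Data.List.Relation.Unary.All using (All)
open import Data.Product using (Σ; ∃; _×_; _,_)
open import Relation.Nullary using (Dec)
open import Function.Bundles using (_⇔_)

Seq : Set
Seq = List ℕ

Subset : Set₁
Subset = Seq → Set

init : (ℕ → ℕ) → ℕ → Seq
init α n = applyUpTo α n

Decidable : Subset → Set
Decidable P = ∀ a → Dec (P a)

_⊆_ : Subset → Subset → Set
P ⊆ Q = ∀ a → P a → Q a

record IsTree (T : Subset) : Set where
  field
    dec       : Decidable T
    inhabited : ∃ λ a → T a
    closed    : ∀ a b → T (a ++ b) → T a

record IsSpread (T : Subset) : Set where
  field
    tree   : IsTree T
    extend : ∀ a → T a → ∃ λ n → T (a ++ [ n ])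

record IsFan (T : Subset) : Set where
  field
    spread  : IsSpread T
    bounded : ∀ a → T a → ∃ λ N → ∀ n → T (a ++ [ n ]) → n ≤ N

IsPath : Subset → (ℕ → ℕ) → Set
IsPath T α = ∀ n → T (init α n)

IsBar : Subset → Subset → Set
IsBar T P = P ⊆ T × (∀ α → IsPath T α → ∃ λ n → P (init α n))

IsUniformBar : Subset → Subset → Set
IsUniformBar T P =
  P ⊆ T × (∃ λ N → ∀ α → IsPath T α → ∃ λ n → n ≤ N × P (init α n))

IsΠ⁰₁ : Subset → Subset → Set₁
IsΠ⁰₁ T P = Σ (ℕ → Subset) λ B →
  (∀ n → Decidable (B n)) × (∀ n → B n ⊆ T) × (∀ a → P a ⇔ (∀ n → B n a))

IsMonotone : Subset → Subset → Set
IsMonotone T P = ∀ a b → P a → T (a ++ b) → P (a ++ b)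

Bin : Subset
Bin a = All (_≤ 1) a

module Submission where

-- A fan T is coded by binary sequences
-- through a "decoder" u ↦ decode u ∈ T: starting at the root, a block of
-- ones counts up to the index of the next child, a zero (or exhausting the
-- branching bound of the current node, which exists because T is a fan)
-- commits to that child.
--
-- Given a coding, a monotone Π⁰₁ bar P of T pulls back to the monotone Π⁰₁
-- bar  { u ∈ {0,1}* | decode u ∈ P }  of the binary fan; a uniform bound for
-- the pullback is a uniform bound for P, because decoding never outruns
-- the binary sequence.

open import Defs
open import Data.Nat using (ℕ; zero; suc; _+_; _≤_; z≤n; s≤s; _<?_; _≤?_)
open import Data.Nat.Properties
  using (≤-antisym; ≮⇒≥; +-suc; +-identityʳ; ≤-trans; ≤-reflexive; <-≤-trans; <-irrefl; n≤1+n; ≤-refl)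
open import Data.List using ([]; _∷_; _++_; _∷ʳ_; foldl)
open import Data.List.Properties using (++-assoc; ++-identityʳ; foldl-++; foldl-∷ʳ; applyUpTo-∷ʳ)
open import Data.List.Relation.Unary.All using (all?)
open import Data.List.Relation.Unary.All.Properties using (applyUpTo⁺₂)
open import Data.Product using (Σ; ∃; ∃₂; _×_; _,_; proj₁; proj₂)
open import Data.Empty using (⊥-elim)
open import Relation.Nullary using (yes; no)
open import Relation.Nullary.Decidable using (_×-dec_)
open import Relation.Binary.PropositionalEquality
  using (_≡_; refl; sym; trans; cong; cong₂; subst)
open import Function.Bundles using (mk⇔; Equivalence)

-- A coding of the tree T by binary sequences.  `lift` says that the
-- decodings along any sequence β run through all initial segments of one
-- sequence γ (necessarily a path of T); `encode` says that every path α of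
-- T is decoded from some binary path β, reaching at stage m a segment of α
-- of length at most m.
record BinaryCoding (T : Subset) : Set where
  field
    decode   : Seq → Seq
    decode-T : ∀ u → T (decode u)
    decode-extends : ∀ u v → ∃ λ x → decode (u ++ v) ≡ decode u ++ x
    lift     : ∀ β → ∃ λ γ → ∀ n → ∃ λ m → decode (init β m) ≡ init γ n
    encode   : ∀ α → IsPath T α → ∃ λ β → IsPath Bin β
               × (∀ m → ∃ λ k → k ≤ m × decode (init β m) ≡ init α k)

module Pullback {T : Subset} (C : BinaryCoding T) (P : Subset) where
  open BinaryCoding C

  pullback : Subset
  pullback u = Bin u × P (decode u)

  -- Monotonicity is inherited because decoding is monotone.
  pullback-monotone : IsMonotone T P → IsMonotone Bin pullback
  pullback-monotone mon a b (_ , Pa) Bin-ab =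
    Bin-ab , subst P (sym e) (mon (decode a) x Pa (subst T e (decode-T (a ++ b))))
    where
    x = proj₁ (decode-extends a b)
    e = proj₂ (decode-extends a b)

  pullback-Π⁰₁ : IsΠ⁰₁ T P → IsΠ⁰₁ Bin pullback
  pullback-Π⁰₁ (B , B-dec , _ , P⇔⋂B) =
      (λ k u → Bin u × B k (decode u))
    , (λ k u → all? (_≤? 1) u ×-dec B-dec k (decode u))
    , (λ k u → proj₁)
    , λ u → mk⇔ (λ (Bin-u , Pu) k → Bin-u , Equivalence.to (P⇔⋂B (decode u)) Pu k)
                (λ h → proj₁ (h 0) , Equivalence.from (P⇔⋂B (decode u)) (λ k → proj₂ (h k)))

  -- A binary path decodes along a path of T, which meets P.
  pullback-bar : IsBar T P → IsBar Bin pullback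
  pullback-bar (_ , bar) = (λ u → proj₁) , λ β β-path →
    let (γ , γ-segments) = lift β
        γ-path : IsPath T γ
        γ-path n = subst T (proj₂ (γ-segments n)) (decode-T _)
        (n , Pγn) = bar γ γ-path
        (m , e) = γ-segments n
    in m , β-path m , subst P (sym e) Pγn

  -- A uniform bound for the pullback bounds P: the coding β of a path α
  -- reaches P within M bits, at a segment of α of length at most M.
  uniform-pushforward : P ⊆ T → IsUniformBar Bin pullback → IsUniformBar T P
  uniform-pushforward P⊆T (_ , M , unif) = P⊆T , M , λ α α-path →
    let (β , β-path , β-decodes) = encode α α-path
        (m , m≤M , (_ , Pm)) = unif β β-path
        (k , k≤m , e) = β-decodes m
    in k , ≤-trans k≤m m≤M , subst P e Pm

module FanCoding (T : Subset) (fan : IsFan T) where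
  open IsFan fan
  open IsSpread spread
  open IsTree tree

  T-root : T []
  T-root = closed [] (proj₁ inhabited) (proj₂ inhabited)

  -- A bound on the children of a (0 outside T).
  bound : Seq → ℕ
  bound a with dec a
  ... | yes Ta = proj₁ (bounded a Ta)
  ... | no _ = 0

  bound-correct : ∀ a n → T a → T (a ∷ʳ n) → n ≤ bound a
  bound-correct a n Ta Tan with dec a
  ... | yes Ta′ = proj₂ (bounded a Ta′) n Tan
  ... | no ¬Ta = ⊥-elim (¬Ta Ta)

  child : Seq → ℕ → ℕ
  child a c with dec (a ∷ʳ c) | dec a
  ... | yes _ | _ = c
  ... | no _ | yes Ta = proj₁ (extend a Ta)
  ... | no _ | no _ = 0

  child-T : ∀ a c → T a → T (a ∷ʳ child a c)
  child-T a c Ta with dec (a ∷ʳ c) | dec a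
  ... | yes Tac | _ = Tac
  ... | no _ | yes Ta′ = proj₂ (extend a Ta′)
  ... | no _ | no ¬Ta = ⊥-elim (¬Ta Ta)

  child-exact : ∀ a c → T (a ∷ʳ c) → child a c ≡ c
  child-exact a c Tac with dec (a ∷ʳ c)
  ... | yes _ = refl
  ... | no ¬Tac = ⊥-elim (¬Tac Tac)

  -- Decoder state: current node, the child index counted so far, and how
  -- many more ones may be counted before the bound of the node is reached.
  record State : Set where
    constructor ⟨_,_,_⟩
    field
      node   : Seq
      count  : ℕ
      budget : ℕ
  open State

  fresh : Seq → State
  fresh a = ⟨ a , 0 , bound a ⟩

  step : State → ℕ → State
  step ⟨ a , c , d ⟩ zero = fresh (a ∷ʳ child a c)
  step ⟨ a , c , zero ⟩ (suc _) = fresh (a ∷ʳ child a c)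
  step ⟨ a , c , suc d ⟩ (suc _) = ⟨ a , suc c , d ⟩

  run : State → Seq → State
  run = foldl step

  start : State
  start = fresh []

  decode : Seq → Seq
  decode u = node (run start u)

  step-extends : ∀ s b → ∃ λ x → node (step s b) ≡ node s ++ x
  step-extends ⟨ a , c , d ⟩ zero = _ , refl
  step-extends ⟨ a , c , zero ⟩ (suc _) = _ , refl
  step-extends ⟨ a , c , suc d ⟩ (suc _) = [] , sym (++-identityʳ a)

  run-extends : ∀ s v → ∃ λ x → node (run s v) ≡ node s ++ x
  run-extends s [] = [] , sym (++-identityʳ (node s))
  run-extends s (b ∷ v) =
    let (y , e₁) = step-extends s b
        (x , e₂) = run-extends (step s b) v
    in y ++ x , trans e₂ (trans (cong (_++ x) e₁) (++-assoc (node s) y x))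

  step-T : ∀ s b → T (node s) → T (node (step s b))
  step-T ⟨ a , c , d ⟩ zero Ta = child-T a c Ta
  step-T ⟨ a , c , zero ⟩ (suc _) Ta = child-T a c Ta
  step-T ⟨ a , c , suc d ⟩ (suc _) Ta = Ta

  run-T : ∀ s v → T (node s) → T (node (run s v))
  run-T s [] Ts = Ts
  run-T s (b ∷ v) Ts = run-T (step s b) v (step-T s b Ts)

  run-next : ∀ β p → run start (init β (suc p)) ≡ step (run start (init β p)) (β p)
  run-next β p = trans (cong (run start) (sym (applyUpTo-∷ʳ β p)))
                       (foldl-∷ʳ step start (β p) (init β p))

  decode-extends : ∀ u v → ∃ λ x → decode (u ++ v) ≡ decode u ++ x
  decode-extends u v =
    let (x , e) = run-extends (run start u) v
    in x , trans (cong node (foldl-++ step start u v)) e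

  module Lift (β : ℕ → ℕ) where
    commits : ∀ p a c d → run start (init β p) ≡ ⟨ a , c , d ⟩
            → ∃₂ λ x q → run start (init β q) ≡ fresh (a ∷ʳ x)
    commits p a c d e with β p in βp
    ... | zero = child a c , suc p , trans (run-next β p) (cong₂ step e βp)
    commits p a c zero e | suc _ = child a c , suc p , trans (run-next β p) (cong₂ step e βp)
    commits p a c (suc d) e | suc _ =
      commits (suc p) a (suc c) d (trans (run-next β p) (cong₂ step e βp))

    Visit : Set
    Visit = Σ Seq λ a → Σ ℕ λ p → run start (init β p) ≡ fresh a

    advance : (v : Visit) → ∃₂ λ x q → run start (init β q) ≡ fresh (proj₁ v ∷ʳ x)
    advance (a , p , e) = commits p a 0 (bound a) e

    visit : ℕ → Visit
    visit zero = [] , 0 , refl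
    visit (suc n) = proj₁ (visit n) ∷ʳ proj₁ (advance (visit n)) , proj₂ (advance (visit n))

    γ : ℕ → ℕ
    γ n = proj₁ (advance (visit n))

    visit-init : ∀ n → init γ n ≡ proj₁ (visit n)
    visit-init zero = refl
    visit-init (suc n) = trans (sym (applyUpTo-∷ʳ γ n)) (cong (_∷ʳ γ n) (visit-init n))

    segments : ∀ n → ∃ λ m → decode (init β m) ≡ init γ n
    segments n = proj₁ (proj₂ (visit n))
               , trans (cong node (proj₂ (proj₂ (visit n)))) (sym (visit-init n))

  -- Coding a path α: the i-th entry is written as α i ones followed by a
  -- zero.  The encoder is itself a machine, whose position (i , c) means
  -- "writing α i, having written c ones".
  module Encode (α : ℕ → ℕ) (α-path : IsPath T α) where
    Pos : Set
    Pos = ℕ × ℕ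

    emit : Pos → ℕ × Pos
    emit (i , c) with c <? α i
    ... | yes _ = 1 , (i , suc c)
    ... | no _ = 0 , (suc i , 0)

    pos : ℕ → Pos
    pos zero = 0 , 0
    pos (suc m) = proj₂ (emit (pos m))

    β : ℕ → ℕ
    β m = proj₁ (emit (pos m))

    β-path : IsPath Bin β
    β-path n = applyUpTo⁺₂ β n (λ m → emit-binary (pos m))
      where
      emit-binary : ∀ p → proj₁ (emit p) ≤ 1
      emit-binary (i , c) with c <? α i
      ... | yes _ = ≤-refl
      ... | no _ = z≤n

    pos-index : ∀ m → proj₁ (pos m) ≤ m
    pos-index zero = z≤n
    pos-index (suc m) = emit-index (pos m) (pos-index m)
      where
      emit-index : ∀ p {m} → proj₁ p ≤ m → proj₁ (proj₂ (emit p)) ≤ suc m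
      emit-index (i , c) i≤m with c <? α i
      ... | yes _ = ≤-trans i≤m (n≤1+n _)
      ... | no _ = s≤s i≤m

    α-child : ∀ i → T (init α i ∷ʳ α i)
    α-child i = subst T (sym (applyUpTo-∷ʳ α i)) (α-path (suc i))

    α-bounded : ∀ i → α i ≤ bound (init α i)
    α-bounded i = bound-correct (init α i) (α i) (α-path i) (α-child i)

    -- The simulation invariant: at encoder position (i , c) the decoder is
    -- at node ᾱi, has counted c ≤ α i, and its budget is the rest of the bound.
    data Tracks : Pos → State → Set where
      tracks : ∀ {i c d} → c ≤ α i → c + d ≡ bound (init α i)
             → Tracks (i , c) ⟨ init α i , c , d ⟩

    tracks-step : ∀ p s → Tracks p s → Tracks (proj₂ (emit p)) (step s (proj₁ (emit p)))
    tracks-step (i , c) _ (tracks {d = d} c≤αi c+d≡) with c <? α i | d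
    ... | yes c<αi | zero = ⊥-elim (<-irrefl refl (<-≤-trans c<αi
            (≤-trans (α-bounded i) (≤-reflexive (trans (sym c+d≡) (+-identityʳ c))))))
    ... | yes c<αi | suc d′ = tracks c<αi (trans (sym (+-suc c d′)) c+d≡)
    ... | no c≮αi | _ = subst (Tracks (suc i , 0)) (cong fresh next-node) (tracks z≤n refl)
      where
      -- the count has reached α i, which is a genuine child of ᾱi
      counted : child (init α i) c ≡ α i
      counted = trans (cong (child (init α i)) (≤-antisym c≤αi (≮⇒≥ c≮αi)))
                      (child-exact (init α i) (α i) (α-child i))
      next-node : init α (suc i) ≡ init α i ∷ʳ child (init α i) c
      next-node = trans (sym (applyUpTo-∷ʳ α i)) (cong (init α i ∷ʳ_) (sym counted))

    tracking : ∀ m → Tracks (pos m) (run start (init β m))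
    tracking zero = tracks z≤n refl
    tracking (suc m) = subst (Tracks (pos (suc m))) (sym (run-next β m))
                             (tracks-step (pos m) _ (tracking m))

    tracked-node : ∀ {p s} → Tracks p s → node s ≡ init α (proj₁ p)
    tracked-node (tracks _ _) = refl

    decodes : ∀ m → ∃ λ k → k ≤ m × decode (init β m) ≡ init α k
    decodes m = proj₁ (pos m) , pos-index m , tracked-node (tracking m)

  coding : BinaryCoding T
  coding = record
    { decode = decode
    ; decode-T = λ u → run-T start u T-root
    ; decode-extends = decode-extends
    ; lift = λ β → Lift.γ β , Lift.segments β
    ; encode = λ α α-path → Encode.β α α-path , Encode.β-path α α-path , Encode.decodes α α-path
    }

lemma2p2 : ((P : Subset) → IsMonotone Bin P → IsΠ⁰₁ Bin P → IsBar Bin P → IsUniformBar Bin P)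
    → (T : Subset) → IsFan T
    → (P : Subset) → IsMonotone T P → IsΠ⁰₁ T P → IsBar T P → IsUniformBar T P
lemma2p2 binary-fan-theorem T fan P mon Π⁰₁ bar =
  uniform-pushforward (proj₁ bar)
    (binary-fan-theorem pullback (pullback-monotone mon) (pullback-Π⁰₁ Π⁰₁) (pullback-bar bar))
  where
  open Pullback (FanCoding.coding T fan) P
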